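{- Let $r$ be a positive integer and let $\mathbb{M}=(V,\mathcal{C})$ be the rank-$r$ uniform matroid on $n\ge r+1$ elements, i.e. $|V|=n$ and $\mathcal{C}=\{C\subseteq V:|C|=r+1\}$. Let $|\mathbb{M}|_K$ be the minimum number of circuit clauses whose conjunction equals $\Phi_{\mathcal{C}}$. Then $|\mathbb{M}|_K=\binom{n}{r}$.
   Context: Boolean functions on $V$ are viewed as functions of subsets; the clause $B\to v$ ($v\notin B$) has true sets the $T$ with $B\not\subseteq T$ or $B\cup\{v\}\subseteq T$; $\Phi_{\mathcal{C}}=\bigwedge_{C\in\mathcal{C}}\bigwedge_{v\in C}((C\setminus\{v\})\to v)$. A circuit clause is a clause $(C\setminus\{v\})\to v$ with $C\in\mathcal{C}$ and $v\in C$; equality is equality of Boolean functions. -}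

module Defs where

open import Data.Nat using (ℕ; suc; _≤_)
open import Data.Nat.Combinatorics using (_C_)
open import Data.Fin using (Fin)
open import Data.Fin.Subset using (Subset; _∈_; _⊆_; _∪_; ⁅_⁆; _-_; ∣_∣)
open import Data.Product using (_×_; _,_; Σ-syntax; ∃-syntax)
open import Data.Sum using (_⊎_)
open import Data.List using (List; length)
open import Data.List.Relation.Unary.All using (All)
open import Data.List.Relation.Unary.Unique.Propositional using (Unique)
open import Function.Bundles using (_⇔_)
open import Relation.Nullary using (¬_)
open import Relation.Binary.PropositionalEquality using (_≡_)

-- A Boolean function on V = Fin n is represented by its set of true sets
-- (a predicate on subsets); equality of Boolean functions = same true sets.
BoolFun : ℕ → Set₁
BoolFun n = Subset n → Set

_≐_ : ∀ {n} → BoolFun n → BoolFun n → Set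
f ≐ g = ∀ T → f T ⇔ g T

clause : ∀ {n} → Subset n → Fin n → BoolFun n
clause B v T = (¬ (B ⊆ T)) ⊎ (B ∪ ⁅ v ⁆ ⊆ T)

IsCircuit : ∀ {n} → ℕ → Subset n → Set
IsCircuit r C = ∣ C ∣ ≡ suc r

IsCircuitClause : ∀ {n} → ℕ → Subset n × Fin n → Set
IsCircuitClause r (C , v) = IsCircuit r C × v ∈ C

circuitClause : ∀ {n} → Subset n × Fin n → BoolFun n
circuitClause (C , v) = clause (C - v) v

Φ : ∀ {n} → ℕ → BoolFun n
Φ {n} r T = ∀ (C : Subset n) (v : Fin n) → IsCircuit r C → v ∈ C → circuitClause (C , v) T

conj : ∀ {n} → List (Subset n × Fin n) → BoolFun n
conj S T = All (λ c → circuitClause c T) S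

Represents : ∀ {n} → ℕ → List (Subset n × Fin n) → Set
Represents r S = All (IsCircuitClause r) S × Unique S × (conj S ≐ Φ r)

{-# OPTIONS --safe #-}
module Submission where

-- Φ holds exactly at V and at the sets of size < r, and a circuit clause is violated at T
-- exactly when its body C ∖ {v}, an r-set, lies in T while v ∉ T.  At an r-set B only clauses
-- with body B can fail, and Φ does fail there, so every representing family has a clause with
-- body B for each of the n C r choices of B.  Conversely one clause B → v(B) per r-set suffices
-- as soon as every T with r ≤ |T| < n contains an r-set B with v(B) ∉ T.  Reading V cyclically,
-- let v(B) be the point where the first block of B ends.  Given T, the r-set made of the last
-- points of the block of T ending just before v(T), topped up if that block is too short with
-- points of T beyond v(T), is a subset B of T with v(B) = v(T) ∉ T.

open import Defs
open import Data.Nat using (ℕ; zero; suc; _+_; _≤_; _<_; z≤n; s≤s; _≤?_; _<?_)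
open import Data.Nat.Properties
  using (≤-pred; ≤-reflexive; ≤-trans; <-irrefl; <⇒≱; ≰⇒>; ≮⇒≥; ≤-antisym; suc-injective; +-comm;
         module ≤-Reasoning)
open import Data.Nat.Combinatorics using (_C_; nCk+nC[k+1]≡[n+1]C[k+1])
open import Data.Fin using (Fin; zero; suc)
open import Data.Fin.Subset
  using (Subset; inside; outside; _∈_; _∉_; _⊆_; _∪_; ⁅_⁆; _-_; ∣_∣; ⊤; ⊥)
open import Data.Fin.Subset.Properties
  using (drop-there; drop-∷-⊆; out⊆; s⊆s; ⊆-refl; ⊆-min; ⊆-max; ∣⊥∣≡0; ∣p∣≤n; ∣p∣≡n⇒p≡⊤;
         p⊆q⇒∣p∣≤∣q∣; p─⊥≡p; ∪-identityʳ; x∈⁅x⁆; q⊆p∪q)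
open import Data.Vec using (_∷_; []; here; there)
open import Data.Vec.Properties using (∷-injectiveʳ; ≡-dec)
import Data.Bool as Bool
open import Data.Maybe using (Maybe; just; nothing; fromMaybe)
import Data.Maybe as Maybe
open import Data.Product using (_×_; _,_; proj₁; proj₂; ∃-syntax; Σ-syntax)
open import Data.Sum using (inj₁; inj₂)
open import Data.List using (List; []; _∷_; [_]; length; map; _++_)
open import Data.List.Properties
  using (length-map; length-++; length-removeAt′; map-∘; map-id-local)
open import Data.List.Relation.Unary.All using (All; []; _∷_)
import Data.List.Relation.Unary.All as All
import Data.List.Relation.Unary.All.Properties as All
import Data.List.Relation.Unary.Any as Any
open import Data.List.Relation.Unary.Unique.Propositional using (Unique; []; _∷_)
import Data.List.Relation.Unary.Unique.Propositional.Properties as Unique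
open import Data.List.Membership.Propositional using (_─_) renaming (_∈_ to _∈ₗ_)
open import Data.List.Membership.Propositional.Properties
  using (∈-map⁺; ∈-map⁻; ∈-++⁺ˡ; ∈-++⁺ʳ; ∈-++⁻)
open import Function using (_∘_; case_of_)
open import Function.Bundles using (mk⇔; Equivalence)
open import Relation.Nullary using (¬_; yes; no; contradiction)
open import Relation.Binary.PropositionalEquality
  using (_≡_; _≢_; refl; sym; trans; cong; cong₂; subst; module ≡-Reasoning)

private
  variable
    n r : ℕ
    p q T B : Subset n
    x : Fin n

p⊆q∧∣q∣≤∣p∣⇒p≡q : p ⊆ q → ∣ q ∣ ≤ ∣ p ∣ → p ≡ q
p⊆q∧∣q∣≤∣p∣⇒p≡q {p = []}          {q = []}          _   _ = refl
p⊆q∧∣q∣≤∣p∣⇒p≡q {p = outside ∷ p} {q = outside ∷ q} p⊆q h =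
  cong (outside ∷_) (p⊆q∧∣q∣≤∣p∣⇒p≡q (drop-∷-⊆ p⊆q) h)
p⊆q∧∣q∣≤∣p∣⇒p≡q {p = inside ∷ p}  {q = inside ∷ q}  p⊆q h =
  cong (inside ∷_) (p⊆q∧∣q∣≤∣p∣⇒p≡q (drop-∷-⊆ p⊆q) (≤-pred h))
p⊆q∧∣q∣≤∣p∣⇒p≡q {p = inside ∷ p}  {q = outside ∷ q} p⊆q _ with () ← p⊆q here
p⊆q∧∣q∣≤∣p∣⇒p≡q {p = outside ∷ p} {q = inside ∷ q}  p⊆q h =
  contradiction (p⊆q⇒∣p∣≤∣q∣ (drop-∷-⊆ p⊆q)) (<⇒≱ h)

∣p∣≡0⇒p≡⊥ : ∣ p ∣ ≡ 0 → p ≡ ⊥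
∣p∣≡0⇒p≡⊥ {p = []}          _     = refl
∣p∣≡0⇒p≡⊥ {p = outside ∷ p} ∣p∣≡0 = cong (outside ∷_) (∣p∣≡0⇒p≡⊥ ∣p∣≡0)

∃-⊆-ofSize : ∀ k (p : Subset n) → k ≤ ∣ p ∣ → ∃[ q ] q ⊆ p × ∣ q ∣ ≡ k
∃-⊆-ofSize {n} zero p _ = ⊥ , ⊆-min p , ∣⊥∣≡0 n
∃-⊆-ofSize (suc k) (outside ∷ p) h =
  let q , q⊆p , ∣q∣≡k = ∃-⊆-ofSize (suc k) p h in outside ∷ q , out⊆ q⊆p , ∣q∣≡k
∃-⊆-ofSize (suc k) (inside ∷ p)  h =
  let q , q⊆p , ∣q∣≡k = ∃-⊆-ofSize k p (≤-pred h) in inside ∷ q , s⊆s q⊆p , cong suc ∣q∣≡k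

∣p∣<n⇒∃∉ : (p : Subset n) → ∣ p ∣ < n → ∃[ x ] x ∉ p
∣p∣<n⇒∃∉ (outside ∷ p) _ = zero , λ ()
∣p∣<n⇒∃∉ (inside ∷ p)  h = let x , x∉p = ∣p∣<n⇒∃∉ p (≤-pred h) in suc x , x∉p ∘ drop-there

x∉p⇒∣p∪⁅x⁆∣≡1+∣p∣ : x ∉ p → ∣ p ∪ ⁅ x ⁆ ∣ ≡ suc ∣ p ∣
x∉p⇒∣p∪⁅x⁆∣≡1+∣p∣ {x = zero}  {p = inside ∷ p}  x∉p = contradiction here x∉p
x∉p⇒∣p∪⁅x⁆∣≡1+∣p∣ {x = zero}  {p = outside ∷ p} _   = cong (suc ∘ ∣_∣) (∪-identityʳ p)
x∉p⇒∣p∪⁅x⁆∣≡1+∣p∣ {x = suc x} {p = inside ∷ p}  x∉p = cong suc (x∉p⇒∣p∪⁅x⁆∣≡1+∣p∣ (x∉p ∘ there))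
x∉p⇒∣p∪⁅x⁆∣≡1+∣p∣ {x = suc x} {p = outside ∷ p} x∉p = x∉p⇒∣p∪⁅x⁆∣≡1+∣p∣ (x∉p ∘ there)

x∉p⇒p∪⁅x⁆-x≡p : x ∉ p → (p ∪ ⁅ x ⁆) - x ≡ p
x∉p⇒p∪⁅x⁆-x≡p {x = zero}  {p = inside ∷ p}  x∉p = contradiction here x∉p
x∉p⇒p∪⁅x⁆-x≡p {x = zero}  {p = outside ∷ p} _   =
  cong (outside ∷_) (trans (p─⊥≡p (p ∪ ⊥)) (∪-identityʳ p))
x∉p⇒p∪⁅x⁆-x≡p {x = suc x} {p = inside ∷ p}  x∉p = cong (inside ∷_) (x∉p⇒p∪⁅x⁆-x≡p (x∉p ∘ there))
x∉p⇒p∪⁅x⁆-x≡p {x = suc x} {p = outside ∷ p} x∉p = cong (outside ∷_) (x∉p⇒p∪⁅x⁆-x≡p (x∉p ∘ there))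

x∈p⇒1+∣p-x∣≡∣p∣ : x ∈ p → suc ∣ p - x ∣ ≡ ∣ p ∣
x∈p⇒1+∣p-x∣≡∣p∣ {p = inside ∷ p}  here        = cong (suc ∘ ∣_∣) (p─⊥≡p p)
x∈p⇒1+∣p-x∣≡∣p∣ {p = inside ∷ p}  (there x∈p) = cong suc (x∈p⇒1+∣p-x∣≡∣p∣ x∈p)
x∈p⇒1+∣p-x∣≡∣p∣ {p = outside ∷ p} (there x∈p) = x∈p⇒1+∣p-x∣≡∣p∣ x∈p

module _ {A : Set} where

  ∈-─⁺ : ∀ {x y : A} {ys} (x∈ys : x ∈ₗ ys) → y ∈ₗ ys → y ≢ x → y ∈ₗ ys ─ x∈ys
  ∈-─⁺ (Any.here refl) (Any.here refl) y≢x = contradiction refl y≢x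
  ∈-─⁺ (Any.here _)    (Any.there y∈ys) _  = y∈ys
  ∈-─⁺ (Any.there _)   (Any.here y≡z)   _  = Any.here y≡z
  ∈-─⁺ (Any.there x∈ys) (Any.there y∈ys) y≢x = Any.there (∈-─⁺ x∈ys y∈ys y≢x)

  Unique∧⊆⇒length≤ : ∀ {xs ys : List A} → Unique xs → All (_∈ₗ ys) xs → length xs ≤ length ys
  Unique∧⊆⇒length≤ []               []              = z≤n
  Unique∧⊆⇒length≤ {x ∷ xs} {ys} (x∉xs ∷ xs!) (x∈ys ∷ xs⊆ys) = begin
    suc (length xs)           ≤⟨ s≤s (Unique∧⊆⇒length≤ xs! (All.zipWith keep (x∉xs , xs⊆ys))) ⟩
    suc (length (ys ─ x∈ys)) ≡⟨ length-removeAt′ ys _ ⟨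
    length ys                ∎
    where
    open ≤-Reasoning
    keep : ∀ {y} → x ≢ y × y ∈ₗ ys → y ∈ₗ ys ─ x∈ys
    keep (x≢y , y∈ys) = ∈-─⁺ x∈ys y∈ys (x≢y ∘ sym)

subsetsOfSize : ∀ n → ℕ → List (Subset n)
subsetsOfSize n       zero    = [ ⊥ ]
subsetsOfSize zero    (suc k) = []
subsetsOfSize (suc n) (suc k) =
  map (outside ∷_) (subsetsOfSize n (suc k)) ++ map (inside ∷_) (subsetsOfSize n k)

length-subsetsOfSize : ∀ n k → length (subsetsOfSize n k) ≡ n C k
length-subsetsOfSize n       zero    = refl
length-subsetsOfSize zero    (suc k) = refl
length-subsetsOfSize (suc n) (suc k) = begin
  length (map (outside ∷_) outs ++ map (inside ∷_) ins)
    ≡⟨ length-++ (map (outside ∷_) outs) ⟩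
  length (map (outside ∷_) outs) + length (map (inside ∷_) ins)
    ≡⟨ cong₂ _+_ (length-map _ outs) (length-map _ ins) ⟩
  length outs + length ins
    ≡⟨ cong₂ _+_ (length-subsetsOfSize n (suc k)) (length-subsetsOfSize n k) ⟩
  n C suc k + n C k
    ≡⟨ +-comm (n C suc k) (n C k) ⟩
  n C k + n C suc k
    ≡⟨ nCk+nC[k+1]≡[n+1]C[k+1] n k ⟩
  suc n C suc k
    ∎
  where
  open ≡-Reasoning
  outs ins : List (Subset n)
  outs = subsetsOfSize n (suc k)
  ins  = subsetsOfSize n k

∈-subsetsOfSize⁻ : ∀ n k {p : Subset n} → p ∈ₗ subsetsOfSize n k → ∣ p ∣ ≡ k
∈-subsetsOfSize⁻ n       zero    (Any.here refl) = ∣⊥∣≡0 n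
∈-subsetsOfSize⁻ (suc n) (suc k) p∈ with ∈-++⁻ (map (outside ∷_) (subsetsOfSize n (suc k))) p∈
... | inj₁ p∈outs with _ , q∈ , refl ← ∈-map⁻ (outside ∷_) p∈outs =
  ∈-subsetsOfSize⁻ n (suc k) q∈
... | inj₂ p∈ins  with _ , q∈ , refl ← ∈-map⁻ (inside ∷_) p∈ins =
  cong suc (∈-subsetsOfSize⁻ n k q∈)

∈-subsetsOfSize⁺ : ∀ n k {p : Subset n} → ∣ p ∣ ≡ k → p ∈ₗ subsetsOfSize n k
∈-subsetsOfSize⁺ n       zero    ∣p∣≡0 = Any.here (∣p∣≡0⇒p≡⊥ ∣p∣≡0)
∈-subsetsOfSize⁺ (suc n) (suc k) {outside ∷ p} ∣p∣≡k =
  ∈-++⁺ˡ (∈-map⁺ (outside ∷_) (∈-subsetsOfSize⁺ n (suc k) ∣p∣≡k))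
∈-subsetsOfSize⁺ (suc n) (suc k) {inside ∷ p}  ∣p∣≡k =
  ∈-++⁺ʳ (map (outside ∷_) (subsetsOfSize n (suc k)))
         (∈-map⁺ (inside ∷_) (∈-subsetsOfSize⁺ n k (suc-injective ∣p∣≡k)))

subsetsOfSize-unique : ∀ n k → Unique (subsetsOfSize n k)
subsetsOfSize-unique n       zero    = [] ∷ []
subsetsOfSize-unique zero    (suc k) = []
subsetsOfSize-unique (suc n) (suc k) =
  Unique.++⁺ (Unique.map⁺ ∷-injectiveʳ (subsetsOfSize-unique n (suc k)))
             (Unique.map⁺ ∷-injectiveʳ (subsetsOfSize-unique n k))
             λ (p∈outs , p∈ins) →
               case ∈-map⁻ (outside ∷_) p∈outs , ∈-map⁻ (inside ∷_) p∈ins of λ where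
                 ((_ , _ , refl) , (_ , _ , ()))

body : Subset n × Fin n → Subset n
body (C , v) = C - v

clauseFrom : Subset n → Fin n → Subset n × Fin n
clauseFrom B v = B ∪ ⁅ v ⁆ , v

clauseFrom-isCircuitClause : ∣ B ∣ ≡ r → x ∉ B → IsCircuitClause r (clauseFrom B x)
clauseFrom-isCircuitClause {B = B} {x = x} ∣B∣≡r x∉B =
  trans (x∉p⇒∣p∪⁅x⁆∣≡1+∣p∣ x∉B) (cong suc ∣B∣≡r) , q⊆p∪q B ⁅ x ⁆ (x∈⁅x⁆ x)

circuitClause-clauseFrom : x ∉ B → circuitClause (clauseFrom B x) T → clause B x T
circuitClause-clauseFrom {x = x} {T = T} x∉B = subst (λ B → clause B x T) (x∉p⇒p∪⁅x⁆-x≡p x∉B)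

∣body∣≡r : ∀ {c : Subset n × Fin n} → IsCircuitClause r c → ∣ body c ∣ ≡ r
∣body∣≡r (∣C∣≡1+r , v∈C) = suc-injective (trans (x∈p⇒1+∣p-x∣≡∣p∣ v∈C) ∣C∣≡1+r)

clause-violated : B ⊆ T → x ∉ T → ¬ clause B x T
clause-violated         B⊆T x∉T (inj₁ B⊈T)   = B⊈T B⊆T
clause-violated {x = x} B⊆T x∉T (inj₂ B∪x⊆T) = x∉T (B∪x⊆T (q⊆p∪q _ ⁅ x ⁆ (x∈⁅x⁆ x)))

Φ-⊤ : Φ r (⊤ {n})
Φ-⊤ C v _ _ = inj₂ (⊆-max _)

Φ-small : ∣ T ∣ < r → Φ r T
Φ-small ∣T∣<r C v ∣C∣≡1+r v∈C =
  inj₁ λ body⊆T →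
    <⇒≱ ∣T∣<r (≤-trans (≤-reflexive (sym (∣body∣≡r (∣C∣≡1+r , v∈C)))) (p⊆q⇒∣p∣≤∣q∣ body⊆T))

circuitClause-offBody : ∀ {c : Subset n × Fin n} → IsCircuitClause r c → ∣ B ∣ ≡ r → body c ≢ B →
                        circuitClause c B
circuitClause-offBody c-circuit ∣B∣≡r body≢B = inj₁ λ body⊆B →
  body≢B (p⊆q∧∣q∣≤∣p∣⇒p≡q body⊆B (≤-reflexive (trans ∣B∣≡r (sym (∣body∣≡r c-circuit)))))

Φ⇒conj : ∀ {S : List (Subset n × Fin n)} → All (IsCircuitClause r) S → Φ r T → conj S T
Φ⇒conj S-circuits Φ[T] = All.map (λ (∣C∣≡1+r , v∈C) → Φ[T] _ _ ∣C∣≡1+r v∈C) S-circuits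

¬Φ-ofSize : ∣ B ∣ ≡ r → x ∉ B → ¬ Φ r B
¬Φ-ofSize {x = x} ∣B∣≡r x∉B Φ[B] =
  let ∣C∣≡1+r , x∈C = clauseFrom-isCircuitClause ∣B∣≡r x∉B
  in clause-violated ⊆-refl x∉B (circuitClause-clauseFrom x∉B (Φ[B] _ x ∣C∣≡1+r x∈C))

Represents⇒bodies-cover : ∀ {S : List (Subset n × Fin n)} → Represents r S → r < n →
                          ∣ B ∣ ≡ r → B ∈ₗ map body S
Represents⇒bodies-cover {n} {B = B} {S = S} (S-circuits , _ , conj≐Φ) r<n ∣B∣≡r
  with Any.any? (≡-dec Bool._≟_ B) (map body S)
... | yes B∈bodies = B∈bodies
... | no  B∉bodies =
  let _ , x∉B = ∣p∣<n⇒∃∉ B (subst (_< n) (sym ∣B∣≡r) r<n)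
  in contradiction (Equivalence.to (conj≐Φ B) (All.tabulate holds)) (¬Φ-ofSize ∣B∣≡r x∉B)
  where
  holds : ∀ {c} → c ∈ₗ S → circuitClause c B
  holds c∈S = circuitClause-offBody (All.lookup S-circuits c∈S) ∣B∣≡r
    λ body≡B → B∉bodies (subst (_∈ₗ map body S) body≡B (∈-map⁺ body c∈S))

Represents⇒C≤length : ∀ {S : List (Subset n × Fin n)} → Represents r S → r < n → n C r ≤ length S
Represents⇒C≤length {n = n} {r = r} {S = S} rep r<n = begin
  n C r                      ≡⟨ length-subsetsOfSize n r ⟨
  length (subsetsOfSize n r) ≤⟨ Unique∧⊆⇒length≤ (subsetsOfSize-unique n r) bodies-cover ⟩
  length (map body S)        ≡⟨ length-map body S ⟩
  length S                   ∎
  where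
  open ≤-Reasoning
  bodies-cover : All (_∈ₗ map body S) (subsetsOfSize n r)
  bodies-cover = All.tabulate (Represents⇒bodies-cover rep r<n ∘ ∈-subsetsOfSize⁻ n r)

firstDescent : Subset n → Maybe (Fin n)
firstDescent []                     = nothing
firstDescent (outside ∷ p)          = Maybe.map suc (firstDescent p)
firstDescent (inside ∷ [])          = nothing
firstDescent (inside ∷ outside ∷ p) = just (suc zero)
firstDescent (inside ∷ inside ∷ p)  = Maybe.map suc (firstDescent (inside ∷ p))

-- The first point outside p whose predecessor lies in p, scanning 1, …, n and then 0, the
-- cyclic successor of n; it lies outside p whenever p ≠ V.
blockExit : Subset (suc n) → Fin (suc n)
blockExit p = fromMaybe zero (firstDescent p)

firstDescent-∉ : ∀ (p : Subset n) {i} → firstDescent p ≡ just i → i ∉ p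
firstDescent-∉ (outside ∷ p) e with firstDescent p in eq
firstDescent-∉ (outside ∷ p) refl | just i = firstDescent-∉ p eq ∘ drop-there
firstDescent-∉ (inside ∷ outside ∷ p) refl = λ { (there ()) }
firstDescent-∉ (inside ∷ inside ∷ p) e with firstDescent (inside ∷ p) in eq
firstDescent-∉ (inside ∷ inside ∷ p) refl | just i = firstDescent-∉ (inside ∷ p) eq ∘ drop-there

firstDescent-inside∷-nothing : (p : Subset n) → firstDescent (inside ∷ p) ≡ nothing →
                               firstDescent p ≡ nothing × ∣ p ∣ ≡ n
firstDescent-inside∷-nothing [] _ = refl , refl
firstDescent-inside∷-nothing (inside ∷ p) e with firstDescent (inside ∷ p) in eq
... | nothing = let _ , ∣p∣≡n = firstDescent-inside∷-nothing p eq in refl , cong suc ∣p∣≡n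

zero∉-noDescent : (p : Subset (suc n)) → firstDescent p ≡ nothing → ∣ p ∣ < suc n → zero ∉ p
zero∉-noDescent (inside ∷ p) e 1+∣p∣<1+n =
  contradiction (proj₂ (firstDescent-inside∷-nothing p e)) λ ∣p∣≡n → <-irrefl ∣p∣≡n (≤-pred 1+∣p∣<1+n)

blockExit-∉ : (p : Subset (suc n)) → ∣ p ∣ < suc n → blockExit p ∉ p
blockExit-∉ p ∣p∣<1+n with firstDescent p in eq
... | just i  = firstDescent-∉ p eq
... | nothing = zero∉-noDescent p eq ∣p∣<1+n

DescentWitness : ℕ → Subset n → Set
DescentWitness r p = ∃[ q ] q ⊆ p × ∣ q ∣ ≡ r × ∃[ k ] firstDescent q ≡ just k × k ∉ p

NoDescentWitness : ℕ → Subset n → Set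
NoDescentWitness r p = ∃[ q ] q ⊆ p × ∣ q ∣ ≡ r × firstDescent q ≡ nothing

DescentWitness-∷ : ∀ s → DescentWitness r p → DescentWitness r (s ∷ p)
DescentWitness-∷ _ (q , q⊆p , ∣q∣≡r , k , eq , k∉p) =
  outside ∷ q , out⊆ q⊆p , ∣q∣≡r , suc k , cong (Maybe.map suc) eq , k∉p ∘ drop-there

NoDescentWitness-∷ : ∀ s → NoDescentWitness r p → NoDescentWitness r (s ∷ p)
NoDescentWitness-∷ _ (q , q⊆p , ∣q∣≡r , eq) =
  outside ∷ q , out⊆ q⊆p , ∣q∣≡r , cong (Maybe.map suc) eq

descent-witness : 1 ≤ r → (p : Subset n) {i : Fin n} → firstDescent p ≡ just i → r ≤ ∣ p ∣ →
                  DescentWitness r p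
descent-witness 1≤r (outside ∷ p) e r≤∣p∣ with firstDescent p in eq
descent-witness 1≤r (outside ∷ p) refl r≤∣p∣ | just i =
  DescentWitness-∷ outside (descent-witness 1≤r p eq r≤∣p∣)
descent-witness {r = suc r} _ (inside ∷ outside ∷ p) refl 1+r≤∣p∣ =
  let q , q⊆p , ∣q∣≡r = ∃-⊆-ofSize r p (≤-pred 1+r≤∣p∣)
  in inside ∷ outside ∷ q , s⊆s (s⊆s q⊆p) , cong suc ∣q∣≡r , suc zero , refl , λ { (there ()) }
descent-witness {r = r} 1≤r (inside ∷ inside ∷ p) e r≤∣p∣
  with firstDescent (inside ∷ p) in eq | r ≤? ∣ inside ∷ p ∣
descent-witness 1≤r (inside ∷ inside ∷ p) refl r≤∣p∣ | just i | yes r≤∣p′∣ =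
  DescentWitness-∷ inside (descent-witness 1≤r (inside ∷ p) eq r≤∣p′∣)
descent-witness 1≤r (inside ∷ inside ∷ p) refl r≤∣p∣ | just i | no r≰∣p′∣ =
  inside ∷ inside ∷ p , ⊆-refl , ≤-antisym (≰⇒> r≰∣p′∣) r≤∣p∣ ,
  suc i , cong (Maybe.map suc) eq , firstDescent-∉ (inside ∷ p) eq ∘ drop-there

noDescent-witness : (p : Subset n) → firstDescent p ≡ nothing → r ≤ ∣ p ∣ → NoDescentWitness r p
noDescent-witness []            _ z≤n   = [] , ⊆-refl , refl , refl
noDescent-witness (outside ∷ p) e r≤∣p∣ with firstDescent p in eq
... | nothing = NoDescentWitness-∷ outside (noDescent-witness p eq r≤∣p∣)
noDescent-witness {r = r} (inside ∷ p) e r≤∣p∣ with r ≤? ∣ p ∣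
... | yes r≤∣p′∣ =
  NoDescentWitness-∷ inside (noDescent-witness p (proj₁ (firstDescent-inside∷-nothing p e)) r≤∣p′∣)
... | no r≰∣p′∣  = inside ∷ p , ⊆-refl , ≤-antisym (≰⇒> r≰∣p′∣) r≤∣p∣ , e

exit-witness : 1 ≤ r → (T : Subset (suc n)) → r ≤ ∣ T ∣ → ∣ T ∣ < suc n →
  ∃[ B ] B ⊆ T × ∣ B ∣ ≡ r × blockExit B ∉ T
exit-witness 1≤r T r≤∣T∣ ∣T∣<1+n with firstDescent T in eq
... | just i =
  let B , B⊆T , ∣B∣≡r , k , eq′ , k∉T = descent-witness 1≤r T eq r≤∣T∣
  in B , B⊆T , ∣B∣≡r , subst (_∉ T) (sym (cong (fromMaybe zero) eq′)) k∉T
... | nothing =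
  let B , B⊆T , ∣B∣≡r , eq′ = noDescent-witness T eq r≤∣T∣
  in B , B⊆T , ∣B∣≡r , subst (_∉ T) (sym (cong (fromMaybe zero) eq′)) (zero∉-noDescent T eq ∣T∣<1+n)

exitClause : Subset (suc n) → Subset (suc n) × Fin (suc n)
exitClause B = clauseFrom B (blockExit B)

exitClauses : ∀ n r → List (Subset (suc n) × Fin (suc n))
exitClauses n r = map exitClause (subsetsOfSize (suc n) r)

module _ (r<1+n : r < suc n) where

  private
    blockExit-∉-ofSize : ∀ {B : Subset (suc n)} → B ∈ₗ subsetsOfSize (suc n) r → blockExit B ∉ B
    blockExit-∉-ofSize {B} B∈ =
      blockExit-∉ B (subst (_< suc n) (sym (∈-subsetsOfSize⁻ _ r B∈)) r<1+n)

  exitClauses-circuits : All (IsCircuitClause r) (exitClauses n r)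
  exitClauses-circuits = All.map⁺ (All.tabulate λ B∈ →
    clauseFrom-isCircuitClause (∈-subsetsOfSize⁻ _ r B∈) (blockExit-∉-ofSize B∈))

  map-body-exitClauses : map body (exitClauses n r) ≡ subsetsOfSize (suc n) r
  map-body-exitClauses = trans (sym (map-∘ (subsetsOfSize (suc n) r)))
    (map-id-local (All.tabulate (x∉p⇒p∪⁅x⁆-x≡p ∘ blockExit-∉-ofSize)))

  exitClauses-unique : Unique (exitClauses n r)
  exitClauses-unique =
    Unique.map⁻ (subst Unique (sym map-body-exitClauses) (subsetsOfSize-unique (suc n) r))

  conj-exitClauses⇒Φ : 1 ≤ r → ∀ T → conj (exitClauses n r) T → Φ r T
  conj-exitClauses⇒Φ 1≤r T holds with ∣ T ∣ <? suc n | r ≤? ∣ T ∣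
  ... | no ∣T∣≮1+n | _ =
    subst (Φ r) (sym (∣p∣≡n⇒p≡⊤ (≤-antisym (∣p∣≤n T) (≮⇒≥ ∣T∣≮1+n)))) Φ-⊤
  ... | yes _ | no r≰∣T∣ = Φ-small (≰⇒> r≰∣T∣)
  ... | yes ∣T∣<1+n | yes r≤∣T∣ =
    let B , B⊆T , ∣B∣≡r , exit∉T = exit-witness 1≤r T r≤∣T∣ ∣T∣<1+n
        B∈ = ∈-subsetsOfSize⁺ (suc n) r ∣B∣≡r
        B→exit-holds = All.lookup holds (∈-map⁺ exitClause B∈)
    in contradiction (circuitClause-clauseFrom (blockExit-∉-ofSize B∈) B→exit-holds)
                     (clause-violated B⊆T exit∉T)

  exitClauses-represent : 1 ≤ r → Represents r (exitClauses n r)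
  exitClauses-represent 1≤r =
    exitClauses-circuits , exitClauses-unique ,
    λ T → mk⇔ (conj-exitClauses⇒Φ 1≤r T) (Φ⇒conj exitClauses-circuits)

length-exitClauses : ∀ n r → length (exitClauses n r) ≡ suc n C r
length-exitClauses n r =
  trans (length-map exitClause (subsetsOfSize (suc n) r)) (length-subsetsOfSize (suc n) r)

theorem23 : (r n : ℕ) → 1 ≤ r → suc r ≤ n →
    (Σ[ S ∈ List (Subset n × Fin n) ] (Represents r S × length S ≡ n C r))
    × (∀ (S : List (Subset n × Fin n)) → Represents r S → n C r ≤ length S)
theorem23 r (suc n) 1≤r r<1+n =
  (exitClauses n r , exitClauses-represent r<1+n 1≤r , length-exitClauses n r) ,
  λ S rep → Represents⇒C≤length rep r<1+n
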